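{- Let $D=(S,C)$ be an ADF and let $\mathrm{co}(D)$ be its set of complete interpretations. Consider the following procedure (which the paper implements with BDD operations, described here on sets): initialize $P:=\emptyset$ and $X:=\mathrm{co}(D)$; while $X\neq\emptyset$: choose some $I\in X$ whose number of arguments mapped to $\star$ is minimal among elements of $X$, let $k$ be that number, let $\mathit{prf}:=\{J\in X : J \text{ has exactly } k \text{ arguments mapped to } \star\}$, set $P:=P\cup\mathit{prf}$, and set $X:=X\setminus\{J' : J'\le_i J\text{ for some }J\in\mathit{prf}\}$. Then this procedure terminates and, upon termination, $P$ is exactly the set of preferred interpretations of $D$.
   Context: An ADF (abstract dialectical framework) is a pair $D=(S,C)$ where $S$ is a finite set of arguments and $C=\{\varphi_s\}_{s\in S}$ assigns to each argument a propositional formula over the variables $S$. A 3-valued interpretation is a map $I:S\to\{0,1,\star\}$. The information ordering $\le_i$ on $\{0,1,\star\}$ is given by $\star\le_i 0$, $\star\le_i 1$ plus reflexivity, extended pointwise to interpretations. For a formula $\varphi$ and interpretation $I$, $\varphi[I]$ substitutes $I(s)$ for each $s$ with $I(s)\in\{0,1\}$. The characteristic operator $\Gamma_D$ maps $I$ to $I'$ where $I'(s)=1$ iff $\varphi_s[I]$ is a tautology, $I'(s)=0$ iff $\varphi_s[I]$ is unsatisfiable, and $I'(s)=\star$ otherwise. $I$ is admissible iff $I\le_i\Gamma_D(I)$, complete iff $I=\Gamma_D(I)$, and preferred iff it is a $\le_i$-maximal admissible interpretation. -}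

module Defs where

open import Data.Nat using (ℕ; zero; suc; _≤_)
open import Data.Bool using (Bool; true; false; not; _∧_; _∨_)
open import Data.Fin using (Fin)
open import Data.Fin.Properties using (all?)
open import Data.Vec using (Vec; []; _∷_; lookup)
open import Data.Product using (Σ; _×_; _,_)
open import Data.Sum using (_⊎_)
open import Data.Unit using (⊤; tt)
open import Data.Empty using (⊥)
open import Relation.Nullary using (Dec; yes; no; ¬_)
open import Relation.Nullary.Decidable using (_→-dec_)
open import Relation.Binary.PropositionalEquality using (_≡_; refl)
open import Data.Bool.Properties using () renaming (_≟_ to _≟ᵇ_)
open import Function.Bundles using (_⇔_)

data Form (n : ℕ) : Set where
  var  : Fin n → Form n
  ⊤f   : Form n
  ⊥f   : Form n
  ¬f_  : Form n → Form n
  _∧f_ : Form n → Form n → Form n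
  _∨f_ : Form n → Form n → Form n
  _⇒f_ : Form n → Form n → Form n

eval : ∀ {n} → Form n → Vec Bool n → Bool
eval (var s)   v = lookup v s
eval ⊤f        v = true
eval ⊥f        v = false
eval (¬f φ)    v = not (eval φ v)
eval (φ ∧f ψ)  v = eval φ v ∧ eval ψ v
eval (φ ∨f ψ)  v = eval φ v ∨ eval ψ v
eval (φ ⇒f ψ)  v = not (eval φ v) ∨ eval ψ v

-- An ADF D = (S, C) with S = Fin n and C = {φ_s}
record ADF (n : ℕ) : Set where
  field
    ac : Fin n → Form n
open ADF public

data V3 : Set where
  𝟘 𝟙 ⋆ : V3

Interp : ℕ → Set
Interp n = Vec V3 n

data _⊑_ : V3 → V3 → Set where
  ⋆⊑   : ∀ {x} → ⋆ ⊑ x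
  refl⊑ : ∀ {x} → x ⊑ x

_≤ᵢ_ : ∀ {n} → Interp n → Interp n → Set
I ≤ᵢ J = ∀ s → lookup I s ⊑ lookup J s

stars : ∀ {n} → Interp n → ℕ
stars []        = 0
stars (𝟘 ∷ I)   = stars I
stars (𝟙 ∷ I)   = stars I
stars (⋆ ∷ I)   = suc (stars I)

-- φ[I]: a two-valued assignment v is a completion of I when it agrees with
-- I on every argument that I assigns 0 or 1.  φ[I] is a tautology iff every
-- completion of I satisfies φ, and unsatisfiable iff no completion does.

Agrees : V3 → Bool → Set
Agrees 𝟘 b = b ≡ false
Agrees 𝟙 b = b ≡ true
Agrees ⋆ b = ⊤

Completion : ∀ {n} → Vec Bool n → Interp n → Set
Completion v I = ∀ s → Agrees (lookup I s) (lookup v s)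

IsTaut : ∀ {n} → Form n → Interp n → Set
IsTaut φ I = ∀ v → Completion v I → eval φ v ≡ true

IsUnsat : ∀ {n} → Form n → Interp n → Set
IsUnsat φ I = ∀ v → Completion v I → eval φ v ≡ false

-- decidability (needed to define Γ_D as a function)
agrees? : ∀ x b → Dec (Agrees x b)
agrees? 𝟘 b = b ≟ᵇ false
agrees? 𝟙 b = b ≟ᵇ true
agrees? ⋆ b = yes tt

completion? : ∀ {n} (v : Vec Bool n) (I : Interp n) → Dec (Completion v I)
completion? v I = all? (λ s → agrees? (lookup I s) (lookup v s))

allVec? : ∀ {n} {P : Vec Bool n → Set} → (∀ v → Dec (P v)) → Dec (∀ v → P v)
allVec? {zero} {P} P? with P? []
... | yes p = yes (λ { [] → p })
... | no ¬p = no (λ h → ¬p (h []))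
allVec? {suc n} {P} P? with allVec? (λ v → P? (true ∷ v)) | allVec? (λ v → P? (false ∷ v))
... | yes pt | yes pf = yes (λ { (true ∷ v) → pt v ; (false ∷ v) → pf v })
... | no ¬pt | _ = no (λ h → ¬pt (λ v → h (true ∷ v)))
... | yes _ | no ¬pf = no (λ h → ¬pf (λ v → h (false ∷ v)))

taut? : ∀ {n} (φ : Form n) (I : Interp n) → Dec (IsTaut φ I)
taut? φ I = allVec? (λ v → completion? v I →-dec (eval φ v ≟ᵇ true))

unsat? : ∀ {n} (φ : Form n) (I : Interp n) → Dec (IsUnsat φ I)
unsat? φ I = allVec? (λ v → completion? v I →-dec (eval φ v ≟ᵇ false))

γ : ∀ {n} → Form n → Interp n → V3
γ φ I with taut? φ I | unsat? φ I
... | yes _ | _     = 𝟙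
... | no _  | yes _ = 𝟘
... | no _  | no _  = ⋆

Γ : ∀ {n} → ADF n → Interp n → Interp n
Γ D I = Data.Vec.tabulate (λ s → γ (ac D s) I)

Admissible : ∀ {n} → ADF n → Interp n → Set
Admissible D I = I ≤ᵢ Γ D I

Complete : ∀ {n} → ADF n → Interp n → Set
Complete D I = I ≡ Γ D I

Preferred : ∀ {n} → ADF n → Interp n → Set
Preferred D I = Admissible D I × (∀ J → Admissible D J → I ≤ᵢ J → J ≡ I)

ISet : ℕ → Set₁
ISet n = Interp n → Set

record State (n : ℕ) : Set₁ where
  constructor ⟨_,_⟩
  field
    P : ISet n
    X : ISet n
open State public

initial : ∀ {n} → ADF n → State n
initial D = ⟨ (λ _ → ⊥) , Complete D ⟩

Prf : ∀ {n} → ISet n → Interp n → ISet n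
Prf X I J = X J × stars J ≡ stars I

Step : ∀ {n} → State n → State n → Set
Step s s' =
  Σ _ λ I → X s I × (∀ J → X s J → stars I ≤ stars J)
    × (∀ J → P s' J ⇔ (P s J ⊎ Prf (X s) I J))
    × (∀ J → X s' J ⇔ (X s J × ¬ (Σ _ λ K → Prf (X s) I K × J ≤ᵢ K)))

Final : ∀ {n} → State n → Set
Final s = ∀ I → ¬ X s I

{-# OPTIONS --safe #-}
-- The loop keeps the invariant: X consists of complete interpretations, none of
-- them below an element of P; every complete interpretation lies in X or below
-- an element of P; and P consists of preferred interpretations.  A ⋆-minimal
-- J ∈ X is then preferred: every admissible interpretation extends to a complete
-- one by iterating Γ, and a complete L ≥ J is either in X, hence equal to J as it
-- has at most as many ⋆ as J, or below an element of P, which the invariant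
-- forbids.  Each round raises the least number of ⋆ in X, so X is empty after at
-- most n + 1 rounds; then every preferred (hence complete) interpretation lies
-- below an element of P, and by maximality equals it.
module Submission where

open import Defs
open import Data.Bool using (Bool; true; false)
open import Data.Empty using (⊥-elim)
open import Data.Fin using (zero; suc)
open import Data.Fin.Properties using (all?)
open import Data.Nat using (ℕ; zero; suc; _+_; _≤_; _<_; _≤?_; _≟_; z≤n; s≤s; s≤s⁻¹)
open import Data.Nat.Induction using (<-wellFounded)
open import Data.Nat.Properties
  using (≤-trans; ≤-<-trans; ≤⇒≯; ≰⇒>; ≤∧≢⇒<; m≤n⇒m≤1+n; m≤m+n; +-suc)
open import Data.Product using (Σ; ∃; _×_; _,_; proj₁; proj₂)
open import Data.Sum using (_⊎_; inj₁; inj₂)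
open import Data.Unit using (tt)
open import Data.Vec using ([]; _∷_; lookup; map)
open import Data.Vec.Properties using (lookup-map; lookup∘tabulate)
open import Function using (id; _∘_)
open import Function.Bundles using (_⇔_; mk⇔; Equivalence)
open import Induction.WellFounded using (Acc; acc)
open import Relation.Binary.Construct.Closure.ReflexiveTransitive using (Star; ε; _◅_)
open import Relation.Binary.PropositionalEquality using (_≡_; _≢_; refl; sym; trans; cong; subst)
open import Relation.Nullary using (Dec; yes; no; ¬_)
open import Relation.Nullary.Decidable using (map′; _×-dec_; _⊎-dec_; ¬?)
open import Relation.Unary using (_∪_; _∩_; ∁)

open Equivalence using (to; from)

⊑-trans : ∀ {x y z} → x ⊑ y → y ⊑ z → x ⊑ z
⊑-trans ⋆⊑    _ = ⋆⊑
⊑-trans refl⊑ q = q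

_⊑?_ : (x y : V3) → Dec (x ⊑ y)
⋆ ⊑? _ = yes ⋆⊑
𝟘 ⊑? 𝟘 = yes refl⊑
𝟘 ⊑? 𝟙 = no λ ()
𝟘 ⊑? ⋆ = no λ ()
𝟙 ⊑? 𝟘 = no λ ()
𝟙 ⊑? 𝟙 = yes refl⊑
𝟙 ⊑? ⋆ = no λ ()

module _ {n : ℕ} where

  ≤ᵢ-refl : (I : Interp n) → I ≤ᵢ I
  ≤ᵢ-refl _ _ = refl⊑

  ≤ᵢ-reflexive : {I J : Interp n} → I ≡ J → I ≤ᵢ J
  ≤ᵢ-reflexive {I} refl = ≤ᵢ-refl I

  ≤ᵢ-trans : (I J K : Interp n) → I ≤ᵢ J → J ≤ᵢ K → I ≤ᵢ K
  ≤ᵢ-trans _ _ _ I≤J J≤K s = ⊑-trans (I≤J s) (J≤K s)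

  _≤ᵢ?_ : (I J : Interp n) → Dec (I ≤ᵢ J)
  I ≤ᵢ? J = all? λ s → lookup I s ⊑? lookup J s

stars≤n : ∀ {n} (I : Interp n) → stars I ≤ n
stars≤n []      = z≤n
stars≤n (𝟘 ∷ I) = m≤n⇒m≤1+n (stars≤n I)
stars≤n (𝟙 ∷ I) = m≤n⇒m≤1+n (stars≤n I)
stars≤n (⋆ ∷ I) = s≤s (stars≤n I)

stars-antitone : ∀ {n} (I J : Interp n) → I ≤ᵢ J → stars J ≤ stars I
stars-antitone []      []      _     = z≤n
stars-antitone (x ∷ I) (y ∷ J) xI≤yJ = ∷-antitone (xI≤yJ zero) (stars-antitone I J (xI≤yJ ∘ suc))
  where
  ∷-antitone : ∀ {x y} → x ⊑ y → stars J ≤ stars I → stars (y ∷ J) ≤ stars (x ∷ I)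
  ∷-antitone (⋆⊑ {𝟘})    = m≤n⇒m≤1+n
  ∷-antitone (⋆⊑ {𝟙})    = m≤n⇒m≤1+n
  ∷-antitone (⋆⊑ {⋆})    = s≤s
  ∷-antitone (refl⊑ {𝟘}) = id
  ∷-antitone (refl⊑ {𝟙}) = id
  ∷-antitone (refl⊑ {⋆}) = s≤s

≤ᵢ∧stars≤⇒≡ : ∀ {n} (I J : Interp n) → I ≤ᵢ J → stars I ≤ stars J → I ≡ J
≤ᵢ∧stars≤⇒≡ []      []      _     _ = refl
≤ᵢ∧stars≤⇒≡ (x ∷ I) (y ∷ J) xI≤yJ = ∷-≡ (xI≤yJ zero)
  where
  I≤J : I ≤ᵢ J
  I≤J = xI≤yJ ∘ suc
  ∷-≡ : ∀ {x y} → x ⊑ y → stars (x ∷ I) ≤ stars (y ∷ J) → x ∷ I ≡ y ∷ J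
  ∷-≡ (⋆⊑ {𝟘})    st = ⊥-elim (≤⇒≯ (stars-antitone I J I≤J) st)
  ∷-≡ (⋆⊑ {𝟙})    st = ⊥-elim (≤⇒≯ (stars-antitone I J I≤J) st)
  ∷-≡ (⋆⊑ {⋆})    st = cong (⋆ ∷_) (≤ᵢ∧stars≤⇒≡ I J I≤J (s≤s⁻¹ st))
  ∷-≡ (refl⊑ {𝟘}) st = cong (𝟘 ∷_) (≤ᵢ∧stars≤⇒≡ I J I≤J st)
  ∷-≡ (refl⊑ {𝟙}) st = cong (𝟙 ∷_) (≤ᵢ∧stars≤⇒≡ I J I≤J st)
  ∷-≡ (refl⊑ {⋆}) st = cong (⋆ ∷_) (≤ᵢ∧stars≤⇒≡ I J I≤J (s≤s⁻¹ st))

≤ᵢ-antisym : ∀ {n} (I J : Interp n) → I ≤ᵢ J → J ≤ᵢ I → I ≡ J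
≤ᵢ-antisym I J I≤J J≤I = ≤ᵢ∧stars≤⇒≡ I J I≤J (stars-antitone J I J≤I)

Agrees-antitone : ∀ {x y b} → x ⊑ y → Agrees y b → Agrees x b
Agrees-antitone ⋆⊑    _ = tt
Agrees-antitone refl⊑ a = a

resolve : V3 → Bool
resolve 𝟘 = false
resolve 𝟙 = true
resolve ⋆ = true

Agrees-resolve : ∀ x → Agrees x (resolve x)
Agrees-resolve 𝟘 = refl
Agrees-resolve 𝟙 = refl
Agrees-resolve ⋆ = tt

module _ {n : ℕ} where

  completion-resolve : (I : Interp n) → Completion (map resolve I) I
  completion-resolve I s =
    subst (Agrees (lookup I s)) (sym (lookup-map s resolve I)) (Agrees-resolve (lookup I s))

  module _ (φ : Form n) where

    IsTaut-mono : (I J : Interp n) → I ≤ᵢ J → IsTaut φ I → IsTaut φ J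
    IsTaut-mono I J I≤J taut v v⊨J = taut v λ s → Agrees-antitone (I≤J s) (v⊨J s)

    IsUnsat-mono : (I J : Interp n) → I ≤ᵢ J → IsUnsat φ I → IsUnsat φ J
    IsUnsat-mono I J I≤J unsat v v⊨J = unsat v λ s → Agrees-antitone (I≤J s) (v⊨J s)

    IsTaut⇒¬IsUnsat : (I : Interp n) → IsTaut φ I → ¬ IsUnsat φ I
    IsTaut⇒¬IsUnsat I taut unsat
      with () ← trans (sym (taut (map resolve I) (completion-resolve I)))
                      (unsat (map resolve I) (completion-resolve I))

    γ-mono : (I J : Interp n) → I ≤ᵢ J → γ φ I ⊑ γ φ J
    γ-mono I J I≤J with taut? φ I | unsat? φ I | taut? φ J | unsat? φ J
    ... | yes _    | _         | yes _    | _         = refl⊑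
    ... | yes taut | _         | no ¬taut | _         = ⊥-elim (¬taut (IsTaut-mono I J I≤J taut))
    ... | no _     | yes unsat | yes taut | _         =
      ⊥-elim (IsTaut⇒¬IsUnsat J taut (IsUnsat-mono I J I≤J unsat))
    ... | no _     | yes _     | no _     | yes _     = refl⊑
    ... | no _     | yes unsat | no _     | no ¬unsat = ⊥-elim (¬unsat (IsUnsat-mono I J I≤J unsat))
    ... | no _     | no _      | _        | _         = ⋆⊑

  module _ (D : ADF n) where

    Γ-mono : (I J : Interp n) → I ≤ᵢ J → Γ D I ≤ᵢ Γ D J
    Γ-mono I J I≤J s
      rewrite lookup∘tabulate (λ t → γ (ac D t) I) s
            | lookup∘tabulate (λ t → γ (ac D t) J) s = γ-mono (ac D s) I J I≤J

    complete? : (I : Interp n) → Dec (Complete D I)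
    complete? I = map′ (λ (I≤ΓI , ΓI≤I) → ≤ᵢ-antisym I (Γ D I) I≤ΓI ΓI≤I)
                       (λ I≡ΓI → ≤ᵢ-reflexive I≡ΓI , ≤ᵢ-reflexive (sym I≡ΓI))
                       (I ≤ᵢ? Γ D I ×-dec Γ D I ≤ᵢ? I)

    preferred⇒complete : (I : Interp n) → Preferred D I → Complete D I
    preferred⇒complete I (I≤ΓI , maximal) = sym (maximal (Γ D I) (Γ-mono I (Γ D I) I≤ΓI) I≤ΓI)

    admissible⇒≤ᵢ-complete : (I : Interp n) → Admissible D I → ∃ λ J → Complete D J × I ≤ᵢ J
    admissible⇒≤ᵢ-complete I I-adm = go I I-adm (<-wellFounded (stars I))
      where
      go : ∀ I → Admissible D I → Acc _<_ (stars I) → ∃ λ J → Complete D J × I ≤ᵢ J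
      go I I≤ΓI (acc rec) with stars I ≤? stars (Γ D I)
      ... | yes fewer = I , ≤ᵢ∧stars≤⇒≡ I (Γ D I) I≤ΓI fewer , ≤ᵢ-refl I
      ... | no more   with go (Γ D I) (Γ-mono I (Γ D I) I≤ΓI) (rec (≰⇒> more))
      ...   | J , J-complete , ΓI≤J = J , J-complete , ≤ᵢ-trans I (Γ D I) J I≤ΓI ΓI≤J

    complete-maximal⇒preferred : (I : Interp n) → Admissible D I
      → (∀ J → Complete D J → I ≤ᵢ J → J ≡ I) → Preferred D I
    complete-maximal⇒preferred I I-adm maximal = I-adm , λ J J-adm I≤J →
      let K , K-complete , J≤K = admissible⇒≤ᵢ-complete J J-adm
          K≡I = maximal K K-complete (≤ᵢ-trans I J K I≤J J≤K)
      in ≤ᵢ-antisym J I (subst (J ≤ᵢ_) K≡I J≤K) I≤J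

∃-V3? : {Q : V3 → Set} → (∀ x → Dec (Q x)) → Dec (∃ Q)
∃-V3? Q? = map′ (λ { (inj₁ q) → 𝟘 , q ; (inj₂ (inj₁ q)) → 𝟙 , q ; (inj₂ (inj₂ q)) → ⋆ , q })
                (λ { (𝟘 , q) → inj₁ q ; (𝟙 , q) → inj₂ (inj₁ q) ; (⋆ , q) → inj₂ (inj₂ q) })
                (Q? 𝟘 ⊎-dec Q? 𝟙 ⊎-dec Q? ⋆)

∃-Interp? : ∀ {n} {Q : Interp n → Set} → (∀ I → Dec (Q I)) → Dec (∃ Q)
∃-Interp? {zero}  Q? = map′ ([] ,_) (λ { ([] , q) → q }) (Q? [])
∃-Interp? {suc n} Q? = map′ (λ { (x , I , q) → x ∷ I , q }) (λ { (x ∷ I , q) → x , I , q })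
                            (∃-V3? λ x → ∃-Interp? λ I → Q? (x ∷ I))

module _ {n : ℕ} where

  StarsAtLeast : ℕ → ISet n → Set
  StarsAtLeast m Y = ∀ J → Y J → m ≤ stars J

  Minimal : ISet n → Interp n → Set
  Minimal Y I = Y I × (∀ J → Y J → stars I ≤ stars J)

  StarsAtLeast[1+n]⇒empty : ∀ {Y} → StarsAtLeast (suc n) Y → ∀ I → ¬ Y I
  StarsAtLeast[1+n]⇒empty bound I I∈Y = ≤⇒≯ (stars≤n I) (bound I I∈Y)

  module _ {Y : ISet n} (Y? : ∀ J → Dec (Y J)) where

    StarsAtLeast⊎minimal : ∀ k → StarsAtLeast k Y ⊎ ∃ (Minimal Y)
    StarsAtLeast⊎minimal zero = inj₁ λ _ _ → z≤n
    StarsAtLeast⊎minimal (suc k) with StarsAtLeast⊎minimal k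
    ... | inj₂ minimal = inj₂ minimal
    ... | inj₁ bound with ∃-Interp? (λ J → Y? J ×-dec stars J ≟ k)
    ...   | yes (I , I∈Y , refl) = inj₂ (I , I∈Y , bound)
    ...   | no none = inj₁ λ J J∈Y → ≤∧≢⇒< (bound J J∈Y) λ k≡ → none (J , J∈Y , sym k≡)

    empty⊎minimal : (∀ I → ¬ Y I) ⊎ ∃ (Minimal Y)
    empty⊎minimal with StarsAtLeast⊎minimal (suc n)
    ... | inj₁ bound   = inj₁ (StarsAtLeast[1+n]⇒empty bound)
    ... | inj₂ minimal = inj₂ minimal

  Prf-minimal : ∀ {Y I J} → Minimal Y I → Prf Y I J → Minimal Y J
  Prf-minimal (_ , I-min) (J∈Y , J≡I) = J∈Y , λ K K∈Y → subst (_≤ stars K) (sym J≡I) (I-min K K∈Y)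

  Below : ISet n → ISet n
  Below Y J = ∃ λ K → Y K × J ≤ᵢ K

  step-raises-stars : ∀ {m s s'} → Step s s' → StarsAtLeast m (X s) → StarsAtLeast (suc m) (X s')
  step-raises-stars (I , I∈X , I-min , _ , X-eq) bound J J∈X' with to (X-eq J) J∈X'
  ... | J∈X , not-below = ≤-<-trans (bound I I∈X) (≤∧≢⇒< (I-min J J∈X) I≢J)
    where
    I≢J : stars I ≢ stars J
    I≢J I≡J = not-below (J , (J∈X , sym I≡J) , ≤ᵢ-refl J)

  step-acc : ∀ rounds {m} (s : State n) → suc n ≤ rounds + m → StarsAtLeast m (X s)
    → Acc (λ s' s → Step s s') s
  step-acc zero    s n<m bound = acc λ (I , I∈X , _) →
    ⊥-elim (StarsAtLeast[1+n]⇒empty (λ J J∈X → ≤-trans n<m (bound J J∈X)) I I∈X)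
  step-acc (suc rounds) {m} s n<rounds+m bound = acc λ step →
    step-acc rounds _ (subst (suc n ≤_) (sym (+-suc rounds m)) n<rounds+m)
                      (step-raises-stars step bound)

  module _ (D : ADF n) where

    record Invariant (s : State n) : Set where
      field
        X-complete       : ∀ J → X s J → Complete D J
        X-not-below-P    : ∀ J K → X s J → P s K → ¬ J ≤ᵢ K
        complete-covered : ∀ J → Complete D J → X s J ⊎ Below (P s) J
        P-preferred      : ∀ J → P s J → Preferred D J
        X?               : ∀ J → Dec (X s J)

    open Invariant

    initial-invariant : Invariant (initial D)
    initial-invariant = record
      { X-complete       = λ _ J-complete → J-complete
      ; X-not-below-P    = λ _ _ _ ()
      ; complete-covered = λ _ → inj₁
      ; P-preferred      = λ _ ()
      ; X?               = complete? D
      }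

    minimal⇒preferred : ∀ {s J} → Invariant s → Minimal (X s) J → Preferred D J
    minimal⇒preferred {J = J} inv (J∈X , J-min) =
      complete-maximal⇒preferred D J (≤ᵢ-reflexive (X-complete inv J J∈X)) maximal
      where
      maximal : ∀ L → Complete D L → J ≤ᵢ L → L ≡ J
      maximal L L-complete J≤L with complete-covered inv L L-complete
      ... | inj₁ L∈X = sym (≤ᵢ∧stars≤⇒≡ J L J≤L (J-min L L∈X))
      ... | inj₂ (K , K∈P , L≤K) = ⊥-elim (X-not-below-P inv J K J∈X K∈P (≤ᵢ-trans J L K J≤L L≤K))

    step-invariant : ∀ {s s'} → Invariant s → Step s s' → Invariant s'
    step-invariant {s} {s'} inv (I , I∈X , I-min , P-eq , X-eq) = record
      { X-complete       = λ J J∈X' → X-complete inv J (proj₁ (to (X-eq J) J∈X'))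
      ; X-not-below-P    = not-below
      ; complete-covered = covered
      ; P-preferred      = preferred
      ; X?               = λ J → map′ (from (X-eq J)) (to (X-eq J))
                                      (X? inv J ×-dec ¬? (below-prf? J))
      }
      where
      prf : ISet n
      prf = Prf (X s) I

      below-prf? : ∀ J → Dec (Below prf J)
      below-prf? J = ∃-Interp? λ K → (X? inv K ×-dec stars K ≟ stars I) ×-dec J ≤ᵢ? K

      not-below : ∀ J K → X s' J → P s' K → ¬ J ≤ᵢ K
      not-below J K J∈X' K∈P' J≤K with to (X-eq J) J∈X' | to (P-eq K) K∈P'
      ... | J∈X , _           | inj₁ K∈P   = X-not-below-P inv J K J∈X K∈P J≤K
      ... | _ , not-below-prf | inj₂ K∈prf = not-below-prf (K , K∈prf , J≤K)

      covered : ∀ J → Complete D J → X s' J ⊎ Below (P s') J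
      covered J J-complete with complete-covered inv J J-complete
      ... | inj₂ (K , K∈P , J≤K) = inj₂ (K , from (P-eq K) (inj₁ K∈P) , J≤K)
      ... | inj₁ J∈X with below-prf? J
      ...   | yes (K , K∈prf , J≤K) = inj₂ (K , from (P-eq K) (inj₂ K∈prf) , J≤K)
      ...   | no not-below-prf      = inj₁ (from (X-eq J) (J∈X , not-below-prf))

      preferred : ∀ J → P s' J → Preferred D J
      preferred J J∈P' with to (P-eq J) J∈P'
      ... | inj₁ J∈P   = P-preferred inv J J∈P
      ... | inj₂ J∈prf = minimal⇒preferred inv (Prf-minimal (I∈X , I-min) J∈prf)

    reachable-invariant : ∀ {s s'} → Invariant s → Star Step s s' → Invariant s'
    reachable-invariant inv ε            = inv
    reachable-invariant inv (step ◅ steps) = reachable-invariant (step-invariant inv step) steps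

    progress : ∀ {s} → Invariant s → Final s ⊎ ∃ (Step s)
    progress {s} inv with empty⊎minimal (X? inv)
    ... | inj₁ empty = inj₁ empty
    ... | inj₂ (I , I∈X , I-min) =
      inj₂ (⟨ P s ∪ Prf (X s) I , X s ∩ ∁ (Below (Prf (X s) I)) ⟩
           , I , I∈X , I-min , (λ _ → mk⇔ id id) , (λ _ → mk⇔ id id))

    final-P⇔preferred : ∀ {s} → Invariant s → Final s → ∀ I → P s I ⇔ Preferred D I
    final-P⇔preferred {s} inv final I = mk⇔ (P-preferred inv I) preferred⇒P
      where
      preferred⇒P : Preferred D I → P s I
      preferred⇒P I-preferred with complete-covered inv I (preferred⇒complete D I I-preferred)
      ... | inj₁ I∈X = ⊥-elim (final I I∈X)
      ... | inj₂ (K , K∈P , I≤K) =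
        subst (P s) (proj₂ I-preferred K (proj₁ (P-preferred inv K K∈P)) I≤K) K∈P

proposition2 : ∀ {n} (D : ADF n)
    → Acc (λ s' s → Step s s') (initial D)
      × (∀ s → Star Step (initial D) s → Final s ⊎ Σ (State n) (λ s' → Step s s'))
      × (∀ s → Star Step (initial D) s → Final s → ∀ I → (P s I ⇔ Preferred D I))
proposition2 {n} D =
    step-acc (suc n) (initial D) (m≤m+n (suc n) 0) (λ _ _ → z≤n)
  , (λ s reach → progress D (reachable reach))
  , (λ s reach → final-P⇔preferred D (reachable reach))
  where
  reachable : ∀ {s} → Star Step (initial D) s → Invariant D s
  reachable = reachable-invariant D (initial-invariant D)
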